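{- Let $n,k$ be natural numbers with $k\le n$, $p$ a prime and $q=p^r$ for some positive integer $r$, and write $\mathbb{F}_q=\{0,\alpha_1,\dots,\alpha_{q-1}\}$. Then $$S_{\mathbb{F}_q}(\boldsymbol{e}_{n,k})=\sum_{m_1=0}^n \sum_{m_2=0}^{n-m_1}\cdots\sum_{m_{q-1}=0}^{n-m_{1}-\cdots-m_{q-2}} {n\choose m_0^*,m_1,m_2,\dots, m_{q-1}} \exp\left(\frac{2\pi i}{p} \mathrm{Tr}_{\mathbb{F}_q/\mathbb{F}_p}\big(\Lambda_{\alpha_1,\dots, \alpha_{q-1}}(k,m_1,\dots, m_{q-1})\big)\right),$$ where $m_0^*=n-(m_1+\cdots+m_{q-1})$.
   Context: $\boldsymbol{e}_{n,k}=\sum_{1\le i_1<\dots<i_k\le n}X_{i_1}\cdots X_{i_k}$. For $F:\mathbb{F}_q^n\to\mathbb{F}_q$, $S_{\mathbb{F}_q}(F)=\sum_{\mathbf{x}\in\mathbb{F}_q^n}\exp\!\big(\tfrac{2\pi i}{p}\mathrm{Tr}_{\mathbb{F}_q/\mathbb{F}_p}(F(\mathbf{x}))\big)$, where $\mathrm{Tr}_{\mathbb{F}_q/\mathbb{F}_p}(\alpha)=\sum_{j=0}^{r-1}\alpha^{p^j}$ with values in $\mathbb{F}_p=\{0,\dots,p-1\}$. For $a_1,a_2,\dots\in\mathbb{F}_q$, an integer $k$ and nonnegative integers $m_i$: $\Lambda_{a_1}(k,m)=a_1^k\binom{m}{k}$ (taken to be $0$ if $k<0$ or $k>m$; binomial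 coefficients mapped into $\mathbb{F}_q$; $a^0=1$), and recursively $\Lambda_{a_1,\dots,a_{l+1}}(k,m_1,\dots,m_{l+1})=\sum_{j=0}^{m_{l+1}}\binom{m_{l+1}}{j}a_{l+1}^j\Lambda_{a_1,\dots,a_l}(k-j,m_1,\dots,m_l)$. -}

module Defs where

open import Level using (0ℓ)
open import Data.Nat as ℕ using (ℕ; zero; suc; _∸_; _≤?_; _!; _/_; NonZero)
open import Data.Nat.Combinatorics using (_C_)
open import Data.Nat.Properties using (m*n≢0; _!≢0)
open import Data.Integer as ℤ using (ℤ; +_; -[1+_])
open import Data.Bool using (Bool; true; false; if_then_else_)
open import Data.Fin using (Fin; toℕ; inject₁; fromℕ) renaming (zero to fzero)
open import Data.Maybe using (Maybe; just; nothing)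
open import Data.List as L using (List; []; _∷_; upTo; concatMap; allFin; length)
open import Data.List.Relation.Unary.Unique.Propositional using (Unique)
open import Data.List.Membership.Propositional using (_∈_)
open import Data.Vec as V using (Vec; []; _∷_)
open import Data.Product using (∃)
open import Relation.Nullary using (yes; no; ¬_)
open import Relation.Binary.PropositionalEquality using (_≡_; _≢_)
open import Relation.Binary.Definitions using (DecidableEquality)
open import Algebra.Structures using (IsCommutativeRing)

record FiniteField (q : ℕ) : Set₁ where
  field
    Carrier : Set
    _+_ _*_ : Carrier → Carrier → Carrier
    -_ : Carrier → Carrier
    0# 1# : Carrier
    isCommutativeRing : IsCommutativeRing _≡_ _+_ _*_ -_ 0# 1#
    _≟_ : DecidableEquality Carrier
    0≢1 : 0# ≢ 1#
    inverse : ∀ x → x ≢ 0# → ∃ λ y → x * y ≡ 1#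
    elems : List Carrier
    elems-unique : Unique elems
    elems-complete : ∀ x → x ∈ elems
    elems-size : length elems ≡ q

module _ {q : ℕ} (F : FiniteField q) where
  open FiniteField F

  pow : Carrier → ℕ → Carrier
  pow a zero = 1#
  pow a (suc j) = a * pow a j

  ℕ→F : ℕ → Carrier
  ℕ→F zero = 0#
  ℕ→F (suc j) = 1# + ℕ→F j

  sumF : List Carrier → Carrier
  sumF = L.foldr _+_ 0#

  Tr : (p r : ℕ) → Carrier → Carrier
  Tr p r a = sumF (L.map (λ j → pow a (p ℕ.^ j)) (upTo r))

  -- identify an element of the prime field with its representative in {0,…,p-1}
  -- (nothing if the element is not of the form t·1 with t < p)
  toFp : (p : ℕ) → Carrier → Maybe (Fin p)
  toFp p β = go (allFin p)
    where
    go : List (Fin p) → Maybe (Fin p)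
    go [] = nothing
    go (t ∷ ts) with ℕ→F (toℕ t) ≟ β
    ... | yes _ = just t
    ... | no _ = go ts

  points : (n : ℕ) → List (Vec Carrier n)
  points zero = [] ∷ []
  points (suc n) = concatMap (λ a → L.map (a ∷_) (points n)) elems

  allBools : (n : ℕ) → List (Vec Bool n)
  allBools zero = [] ∷ []
  allBools (suc n) = concatMap (λ b → L.map (b ∷_) (allBools n)) (true ∷ false ∷ [])

  countTrue : ∀ {n} → Vec Bool n → ℕ
  countTrue [] = 0
  countTrue (true ∷ bs) = suc (countTrue bs)
  countTrue (false ∷ bs) = countTrue bs

  prodSel : ∀ {n} → Vec Bool n → Vec Carrier n → Carrier
  prodSel [] [] = 1#
  prodSel (true ∷ bs) (x ∷ xs) = x * prodSel bs xs
  prodSel (false ∷ bs) (x ∷ xs) = prodSel bs xs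

  esym : (n k : ℕ) → Vec Carrier n → Carrier
  esym n k x = sumF (L.map (λ b → if isK (countTrue b) then prodSel b x else 0#) (allBools n))
    where
    isK : ℕ → Bool
    isK c with c ℕ.≟ k
    ... | yes _ = true
    ... | no _ = false

  Λ₁ : Carrier → ℤ → ℕ → Carrier
  Λ₁ a -[1+ _ ] m = 0#
  Λ₁ a (+ j) m with j ≤? m
  ... | yes _ = pow a j * ℕ→F (m C j)
  ... | no _ = 0#

  Λ : (l : ℕ) → (Fin (suc l) → Carrier) → ℤ → (Fin (suc l) → ℕ) → Carrier
  Λ zero a k m = Λ₁ (a fzero) k (m fzero)
  Λ (suc l) a k m =
    sumF (L.map (λ j → ℕ→F (M C j) * (pow aL j * Λ l (λ i → a (inject₁ i)) (k ℤ.- + j) (λ i → m (inject₁ i))))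
                (upTo (suc M)))
    where
    M = m (fromℕ (suc l))
    aL = a (fromℕ (suc l))

prodFact : ∀ {s} → Vec ℕ s → ℕ
prodFact [] = 1
prodFact (m ∷ ms) = m ! ℕ.* prodFact ms

prodFact≢0 : ∀ {s} (ms : Vec ℕ s) → NonZero (prodFact ms)
prodFact≢0 [] = _
prodFact≢0 (m ∷ ms) = m*n≢0 (m !) (prodFact ms) {{m !≢0}} {{prodFact≢0 ms}}

multinomial : ∀ {s} → ℕ → Vec ℕ s → ℕ
multinomial n ms = (n ! / prodFact ms) {{prodFact≢0 ms}}

tuples : (s b : ℕ) → List (Vec ℕ s)
tuples zero b = [] ∷ []
tuples (suc s) b = concatMap (λ m → L.map (m ∷_) (tuples s (b ∸ m))) (upTo (suc b))

-- Integer combinations of p-th roots of unity.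
-- f : Fin p → ℤ represents Σ_t f(t) exp(2πi t / p) ∈ ℂ.
-- For p prime, Σ_t f(t) ζ^t = Σ_t g(t) ζ^t in ℂ iff f - g is constant
-- (1 + ζ + ⋯ + ζ^{p-1} = 0 is the only relation), so we use that equality.

ExpSum : ℕ → Set
ExpSum p = Fin p → ℤ

_≈ζ_ : ∀ {p} → ExpSum p → ExpSum p → Set
f ≈ζ g = ∃ λ c → ∀ t → f t ≡ g t ℤ.+ c

zeroE : ∀ {p} → ExpSum p
zeroE t = + 0

_⊕_ : ∀ {p} → ExpSum p → ExpSum p → ExpSum p
(f ⊕ g) t = f t ℤ.+ g t

-- c · exp(2πi t₀ / p)   (0 if the exponent is undefined)
term : ∀ {p} → ℕ → Maybe (Fin p) → ExpSum p
term c nothing t = + 0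
term c (just t₀) t with toℕ t₀ ℕ.≟ toℕ t
... | yes _ = + c
... | no _ = + 0

sumE : ∀ {p} → List (ExpSum p) → ExpSum p
sumE = L.foldr _⊕_ zeroE

module _ {q : ℕ} (F : FiniteField q) (p r : ℕ) where
  open FiniteField F

  ψ : Carrier → ExpSum p
  ψ β = term 1 (toFp F p (Tr F p r β))

  S-esym : (n k : ℕ) → ExpSum p
  S-esym n k = sumE (L.map (λ x → ψ (esym F n k x)) (points F n))

  RHS : (l : ℕ) → (Fin (suc l) → Carrier) → (n k : ℕ) → ExpSum p
  RHS l α n k = sumE (L.map rhsTerm (tuples (suc l) n))
    where
    rhsTerm : Vec ℕ (suc l) → ExpSum p
    rhsTerm ms = term (multinomial n ((n ∸ V.sum ms) ∷ ms))
                      (toFp F p (Tr F p r (Λ F l α (+ k) (V.lookup ms))))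

-- Expanding ∏ⱼ (1 + xⱼ T) shows that e_{n,k}(x) is the coefficient of Tᵏ in ∏ᵢ (1 + αᵢ T)^{mᵢ},
-- where mᵢ is the number of coordinates of x equal to αᵢ; and Λ(k, m) is exactly that coefficient,
-- since its recursion multiplies in one binomial power (1 + αᵢ T)^{mᵢ} at a time.  Hence ψ(e_{n,k}(x))
-- depends only on the type m of x, and grouping the points of F_q^n by type gives the right-hand
-- side: both the number of points of type m and the multinomial coefficient obey the multinomial
-- Pascal rule in n.
module Submission where

open import Defs
open import Data.Nat as ℕ using (ℕ; zero; suc; _≤_; _^_; _∸_; _!; _≤?_)
open import Data.Nat.Primality using (Prime)
open import Data.Fin as Fin using (Fin; inject₁; fromℕ; toℕ)
open import Data.Product using (∃; Σ; _,_; proj₁; proj₂)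
open import Relation.Binary.PropositionalEquality using (_≡_; _≢_; refl; sym; trans; cong; cong₂; subst; module ≡-Reasoning)
open import Function.Definitions using (Injective)

open import Level using (0ℓ)
import Data.Nat.Properties as ℕ
open import Data.Nat.Combinatorics using (_C_; nCk+nC[k+1]≡[n+1]C[k+1]; k>n⇒nCk≡0; nCk≡n!/k![n-k]!; k![n∸k]!∣n!)
open import Data.Nat.DivMod using (m/n*n≡m; m*n/n≡m; /-congˡ)
open import Data.Nat.ListAction.Properties using (sum-↭)
open import Data.Nat.Solver using (module +-*-Solver)
open import Data.Integer as ℤ using (ℤ; +_; -[1+_])
import Data.Integer.Properties as ℤ
open import Data.Integer.Tactic.RingSolver using (solve-∀)
open import Data.Fin.Properties using (fromℕ≢inject₁; inject₁-injective)
open import Data.Fin.Relation.Unary.Top using (view; ‵fromℕ; ‵inject₁)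
open import Data.Bool using (Bool; true; false; if_then_else_)
open import Data.Maybe using (Maybe; just; nothing)
open import Data.Sum using (_⊎_; inj₁; inj₂)
open import Data.List as List using (List; []; _∷_; _++_; [_]; upTo; allFin)
open import Data.List.Properties using (map-applyUpTo; applyUpTo-∷ʳ; map-tabulate)
open import Data.List.Membership.Propositional using (_∈_; find)
open import Data.List.Membership.Propositional.Properties using (∈-upTo⁻; ∈-concatMap⁻; ∈-map⁻; ∈-map⁺; ∈-allFin)
open import Data.List.Membership.Propositional.Properties.WithK using (unique∧set⇒bag)
open import Data.List.Relation.Binary.BagAndSetEquality using (∼bag⇒↭)
open import Data.List.Relation.Binary.Permutation.Propositional using (_↭_)
import Data.List.Relation.Binary.Permutation.Propositional.Properties as ↭
open import Data.List.Relation.Unary.All using (universal)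
import Data.List.Relation.Unary.All.Properties as All
open import Data.List.Relation.Unary.AllPairs using (_∷_)
open import Data.List.Relation.Unary.Any using (here; there)
import Data.List.Relation.Unary.Unique.Propositional.Properties as Unique
open import Data.Vec as Vec using (Vec; []; _∷_)
import Data.Vec.Properties as Vec
open import Function using (_∘_; id)
open import Function.Bundles using (mk⇔)
open import Relation.Nullary using (yes; no; does)
open import Relation.Nullary.Decidable using (dec-true; dec-false)
open import Algebra.Bundles using (CommutativeSemiring; CommutativeRing)
open import Algebra.Structures using (IsCommutativeSemiring; IsCommutativeRing)
import Algebra.Properties.CommutativeSemigroup as CommutativeSemigroupProperties

k-[i+j]≡k-i-j : ∀ k i j → k ℤ.- (i ℤ.+ j) ≡ (k ℤ.- i) ℤ.- j
k-[i+j]≡k-i-j = solve-∀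

k-i-j≡k-j-i : ∀ k i j → (k ℤ.- i) ℤ.- j ≡ (k ℤ.- j) ℤ.- i
k-i-j≡k-j-i = solve-∀

module ListSum {A : Set} {_+_ _*_ : A → A → A} {0# 1# : A}
  (isCommutativeSemiring : IsCommutativeSemiring _≡_ _+_ _*_ 0# 1#) where

  open IsCommutativeSemiring isCommutativeSemiring
    using (+-assoc; +-identityˡ; +-identityʳ; distribˡ; distribʳ; zeroˡ; zeroʳ)
  private
    semiring : CommutativeSemiring 0ℓ 0ℓ
    semiring = record { isCommutativeSemiring = isCommutativeSemiring }
    module + = CommutativeSemigroupProperties (CommutativeSemiring.+-commutativeSemigroup semiring)
  open ≡-Reasoning

  ∑ : {X : Set} → List X → (X → A) → A
  ∑ xs f = List.foldr _+_ 0# (List.map f xs)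

  ∑-cong-local : {X : Set} (xs : List X) {f g : X → A} →
                 (∀ {x} → x ∈ xs → f x ≡ g x) → ∑ xs f ≡ ∑ xs g
  ∑-cong-local []       f≡g = refl
  ∑-cong-local (x ∷ xs) f≡g = cong₂ _+_ (f≡g (here refl)) (∑-cong-local xs (f≡g ∘ there))

  ∑-cong : {X : Set} (xs : List X) {f g : X → A} → (∀ x → f x ≡ g x) → ∑ xs f ≡ ∑ xs g
  ∑-cong xs f≡g = ∑-cong-local xs λ {x} _ → f≡g x

  ∑-zero : {X : Set} (xs : List X) {f : X → A} → (∀ x → f x ≡ 0#) → ∑ xs f ≡ 0#
  ∑-zero []       f≡0 = refl
  ∑-zero (x ∷ xs) f≡0 = trans (cong₂ _+_ (f≡0 x) (∑-zero xs f≡0)) (+-identityˡ 0#)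

  ∑-+ : {X : Set} (xs : List X) (f g : X → A) → ∑ xs (λ x → f x + g x) ≡ ∑ xs f + ∑ xs g
  ∑-+ []       f g = sym (+-identityˡ 0#)
  ∑-+ (x ∷ xs) f g = trans (cong (_+_ (f x + g x)) (∑-+ xs f g)) (+.interchange (f x) (g x) _ _)

  ∑-*ˡ : {X : Set} (xs : List X) (c : A) (f : X → A) → ∑ xs (λ x → c * f x) ≡ c * ∑ xs f
  ∑-*ˡ []       c f = sym (zeroʳ c)
  ∑-*ˡ (x ∷ xs) c f = trans (cong (_+_ (c * f x)) (∑-*ˡ xs c f)) (sym (distribˡ c (f x) _))

  ∑-++ : {X : Set} (xs ys : List X) (f : X → A) → ∑ (xs ++ ys) f ≡ ∑ xs f + ∑ ys f
  ∑-++ []       ys f = sym (+-identityˡ _)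
  ∑-++ (x ∷ xs) ys f = trans (cong (_+_ (f x)) (∑-++ xs ys f)) (sym (+-assoc (f x) _ _))

  ∑-map : {X Y : Set} (g : Y → X) (ys : List Y) (f : X → A) →
          ∑ (List.map g ys) f ≡ ∑ ys (f ∘ g)
  ∑-map g []       f = refl
  ∑-map g (y ∷ ys) f = cong (_+_ (f (g y))) (∑-map g ys f)

  ∑-concatMap : {X Y : Set} (g : Y → List X) (ys : List Y) (f : X → A) →
                ∑ (List.concatMap g ys) f ≡ ∑ ys (λ y → ∑ (g y) f)
  ∑-concatMap g []       f = refl
  ∑-concatMap g (y ∷ ys) f =
    trans (∑-++ (g y) (List.concatMap g ys) f) (cong (_+_ (∑ (g y) f)) (∑-concatMap g ys f))

  ∑-comm : {X Y : Set} (xs : List X) (ys : List Y) (f : X → Y → A) →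
           ∑ xs (λ x → ∑ ys (f x)) ≡ ∑ ys (λ y → ∑ xs (λ x → f x y))
  ∑-comm []       ys f = sym (∑-zero ys λ _ → refl)
  ∑-comm (x ∷ xs) ys f = trans (cong (_+_ (∑ ys (f x))) (∑-comm xs ys f)) (sym (∑-+ ys (f x) _))

  ∑-upTo-suc : ∀ n (f : ℕ → A) → ∑ (upTo (suc n)) f ≡ f 0 + ∑ (upTo n) (f ∘ suc)
  ∑-upTo-suc n f =
    cong (_+_ (f 0)) (trans (cong (λ js → ∑ js f) (sym (map-applyUpTo id suc n))) (∑-map suc (upTo n) f))

  ∑-upTo-last : ∀ n (f : ℕ → A) → ∑ (upTo (suc n)) f ≡ ∑ (upTo n) f + f n
  ∑-upTo-last n f = begin
    ∑ (upTo (suc n)) f         ≡⟨ cong (λ js → ∑ js f) (sym (applyUpTo-∷ʳ id n)) ⟩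
    ∑ (upTo n ++ [ n ]) f      ≡⟨ ∑-++ (upTo n) [ n ] f ⟩
    ∑ (upTo n) f + (f n + 0#)  ≡⟨ cong (_+_ (∑ (upTo n) f)) (+-identityʳ (f n)) ⟩
    ∑ (upTo n) f + f n         ∎

  ∑-allFin-suc : ∀ s (f : Fin (suc s) → A) → ∑ (allFin (suc s)) f ≡ f Fin.zero + ∑ (allFin s) (f ∘ Fin.suc)
  ∑-allFin-suc s f =
    cong (_+_ (f Fin.zero)) (trans (cong (λ is → ∑ is f) (sym (map-tabulate id Fin.suc))) (∑-map Fin.suc (allFin s) f))

  ∑-pascal : (ι : ℕ → A) → ι 0 ≡ 0# → (∀ m n → ι (m ℕ.+ n) ≡ ι m + ι n) → ∀ M (f : ℕ → A) →
             ∑ (upTo (suc (suc M))) (λ j → ι (suc M C j) * f j)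
             ≡ ∑ (upTo (suc M)) (λ j → ι (M C j) * f j) + ∑ (upTo (suc M)) (λ j → ι (M C j) * f (suc j))
  ∑-pascal ι ι-0 ι-+ M f = begin
    ∑ (upTo (suc (suc M))) (λ j → ι (suc M C j) * f j)
      ≡⟨ ∑-upTo-suc (suc M) _ ⟩
    g 0 + ∑ (upTo (suc M)) (λ j → ι (suc M C suc j) * f (suc j))
      ≡⟨ cong (_+_ (g 0)) (trans (∑-cong (upTo (suc M)) split) (∑-+ (upTo (suc M)) _ _)) ⟩
    g 0 + (S + ∑ (upTo (suc M)) (g ∘ suc))
      ≡⟨ +.x∙yz≈xz∙y (g 0) S _ ⟩
    (g 0 + ∑ (upTo (suc M)) (g ∘ suc)) + S
      ≡⟨ cong (_+ S) (trans (sym (∑-upTo-suc (suc M) g)) (∑-upTo-last (suc M) g)) ⟩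
    (∑ (upTo (suc M)) g + g (suc M)) + S
      ≡⟨ cong (λ t → (∑ (upTo (suc M)) g + t) + S) last-vanishes ⟩
    (∑ (upTo (suc M)) g + 0#) + S
      ≡⟨ cong (_+ S) (+-identityʳ _) ⟩
    ∑ (upTo (suc M)) g + S ∎
    where
    g : ℕ → A
    g j = ι (M C j) * f j
    S : A
    S = ∑ (upTo (suc M)) (λ j → ι (M C j) * f (suc j))
    split : ∀ j → ι (suc M C suc j) * f (suc j) ≡ (ι (M C j) * f (suc j)) + g (suc j)
    split j = begin
      ι (suc M C suc j) * f (suc j)              ≡⟨ cong (λ c → ι c * f (suc j)) (sym (nCk+nC[k+1]≡[n+1]C[k+1] M j)) ⟩
      ι (M C j ℕ.+ M C suc j) * f (suc j)        ≡⟨ cong (_* f (suc j)) (ι-+ (M C j) (M C suc j)) ⟩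
      (ι (M C j) + ι (M C suc j)) * f (suc j)    ≡⟨ distribʳ (f (suc j)) _ _ ⟩
      (ι (M C j) * f (suc j)) + g (suc j)        ∎
    last-vanishes : g (suc M) ≡ 0#
    last-vanishes = trans (cong (λ c → ι c * f (suc M)) (k>n⇒nCk≡0 (ℕ.n<1+n M)))
                          (trans (cong (_* f (suc M)) ι-0) (zeroˡ (f (suc M))))

module Coefficients {q : ℕ} (F : FiniteField q) where
  open FiniteField F renaming (_+_ to infixl 6 _+_; _*_ to infixl 7 _*_)
  open IsCommutativeRing isCommutativeRing
    using (+-assoc; +-comm; +-identityˡ; +-identityʳ; *-assoc; *-identityˡ; distribˡ; zeroˡ; zeroʳ; isCommutativeSemiring)
  open ListSum isCommutativeSemiring
  open ≡-Reasoning
  private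
    commutativeRing : CommutativeRing 0ℓ 0ℓ
    commutativeRing = record { isCommutativeRing = isCommutativeRing }
    module * = CommutativeSemigroupProperties (CommutativeRing.*-commutativeSemigroup commutativeRing)

  -- c : Series stands for Σₖ c k Tᵏ; mulLinear a and mulBinomialPower a M multiply it by 1 + aT and
  -- (1 + aT)^M.  Λ (suc l) unfolds to mulBinomialPower, so Λ l a k m is the coefficient of Tᵏ in
  -- ∏ᵢ (1 + aᵢ T)^{mᵢ}.
  Series : Set
  Series = ℤ → Carrier

  oneSeries : Series
  oneSeries (+ zero)  = 1#
  oneSeries (+ suc _) = 0#
  oneSeries -[1+ _ ]  = 0#

  mulLinear : Carrier → Series → Series
  mulLinear a c k = c k + a * c (k ℤ.- + 1)

  mulBinomialPower : Carrier → ℕ → Series → Series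
  mulBinomialPower a M c k = ∑ (upTo (suc M)) λ j → ℕ→F F (M C j) * (pow F a j * c (k ℤ.- + j))

  ℕ→F-+ : ∀ m n → ℕ→F F (m ℕ.+ n) ≡ ℕ→F F m + ℕ→F F n
  ℕ→F-+ zero    n = sym (+-identityˡ _)
  ℕ→F-+ (suc m) n = trans (cong (_+_ 1#) (ℕ→F-+ m n)) (sym (+-assoc 1# _ _))

  mulLinear-cong : ∀ a {c c′ : Series} → (∀ k → c k ≡ c′ k) → ∀ k → mulLinear a c k ≡ mulLinear a c′ k
  mulLinear-cong a c≗c′ k = cong₂ (λ u v → u + a * v) (c≗c′ k) (c≗c′ (k ℤ.- + 1))

  mulLinear-0# : ∀ (c : Series) k → mulLinear 0# c k ≡ c k
  mulLinear-0# c k = trans (cong (_+_ (c k)) (zeroˡ _)) (+-identityʳ (c k))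

  mulBinomialPower-cong : ∀ a {M M′} {c c′ : Series} → M ≡ M′ → (∀ k → c k ≡ c′ k) →
                          ∀ k → mulBinomialPower a M c k ≡ mulBinomialPower a M′ c′ k
  mulBinomialPower-cong a {M} refl c≗c′ k =
    ∑-cong (upTo (suc M)) λ j → cong (λ v → ℕ→F F (M C j) * (pow F a j * v)) (c≗c′ _)

  mulBinomialPower-zero : ∀ a (c : Series) k → mulBinomialPower a 0 c k ≡ c k
  mulBinomialPower-zero a c k = begin
    (1# + 0#) * (1# * c (k ℤ.+ + 0)) + 0#   ≡⟨ +-identityʳ _ ⟩
    (1# + 0#) * (1# * c (k ℤ.+ + 0))        ≡⟨ cong₂ _*_ (+-identityʳ 1#) (*-identityˡ _) ⟩
    1# * c (k ℤ.+ + 0)                      ≡⟨ *-identityˡ _ ⟩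
    c (k ℤ.+ + 0)                           ≡⟨ cong c (ℤ.+-identityʳ k) ⟩
    c k                                     ∎

  mulBinomialPower-suc : ∀ a M (c : Series) k →
                         mulBinomialPower a (suc M) c k ≡ mulLinear a (mulBinomialPower a M c) k
  mulBinomialPower-suc a M c k =
    trans (∑-pascal (ℕ→F F) refl ℕ→F-+ M (λ j → pow F a j * c (k ℤ.- + j)))
          (cong (_+_ (mulBinomialPower a M c k)) (trans (∑-cong (upTo (suc M)) factor-a) (∑-*ˡ (upTo (suc M)) a _)))
    where
    factor-a : ∀ j → ℕ→F F (M C j) * (pow F a (suc j) * c (k ℤ.- + suc j))
                     ≡ a * (ℕ→F F (M C j) * (pow F a j * c ((k ℤ.- + 1) ℤ.- + j)))
    factor-a j = begin
      ℕ→F F (M C j) * ((a * pow F a j) * c (k ℤ.- + suc j))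
        ≡⟨ cong (λ i → ℕ→F F (M C j) * ((a * pow F a j) * c i)) (k-[i+j]≡k-i-j k (+ 1) (+ j)) ⟩
      ℕ→F F (M C j) * ((a * pow F a j) * c ((k ℤ.- + 1) ℤ.- + j))
        ≡⟨ cong (ℕ→F F (M C j) *_) (*-assoc a (pow F a j) _) ⟩
      ℕ→F F (M C j) * (a * (pow F a j * c ((k ℤ.- + 1) ℤ.- + j)))
        ≡⟨ *.x∙yz≈y∙xz (ℕ→F F (M C j)) a _ ⟩
      a * (ℕ→F F (M C j) * (pow F a j * c ((k ℤ.- + 1) ℤ.- + j))) ∎

  mulBinomialPower-mulLinear : ∀ a M b (c : Series) k →
    mulBinomialPower a M (mulLinear b c) k ≡ mulLinear b (mulBinomialPower a M c) k
  mulBinomialPower-mulLinear a M b c k =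
    trans (∑-cong (upTo (suc M)) expand)
          (trans (∑-+ (upTo (suc M)) _ _) (cong (_+_ (mulBinomialPower a M c k)) (∑-*ˡ (upTo (suc M)) b _)))
    where
    expand : ∀ j → ℕ→F F (M C j) * (pow F a j * mulLinear b c (k ℤ.- + j))
                   ≡ ℕ→F F (M C j) * (pow F a j * c (k ℤ.- + j))
                     + b * (ℕ→F F (M C j) * (pow F a j * c ((k ℤ.- + 1) ℤ.- + j)))
    expand j = begin
      ι * (p * (c (k ℤ.- + j) + b * c ((k ℤ.- + j) ℤ.- + 1)))
        ≡⟨ cong (λ i → ι * (p * (c (k ℤ.- + j) + b * c i))) (k-i-j≡k-j-i k (+ j) (+ 1)) ⟩
      ι * (p * (c (k ℤ.- + j) + b * c ((k ℤ.- + 1) ℤ.- + j)))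
        ≡⟨ cong (ι *_) (distribˡ p _ _) ⟩
      ι * (p * c (k ℤ.- + j) + p * (b * c ((k ℤ.- + 1) ℤ.- + j)))
        ≡⟨ distribˡ ι _ _ ⟩
      ι * (p * c (k ℤ.- + j)) + ι * (p * (b * c ((k ℤ.- + 1) ℤ.- + j)))
        ≡⟨ cong (λ v → ι * (p * c (k ℤ.- + j)) + v)
                (trans (cong (ι *_) (*.x∙yz≈y∙xz p b _)) (*.x∙yz≈y∙xz ι b _)) ⟩
      ι * (p * c (k ℤ.- + j)) + b * (ι * (p * c ((k ℤ.- + 1) ℤ.- + j))) ∎
      where
      ι = ℕ→F F (M C j)
      p = pow F a j

  Λ₁-+ : ∀ a j m → Λ₁ F a (+ j) m ≡ pow F a j * ℕ→F F (m C j)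
  Λ₁-+ a j m with j ≤? m
  ... | yes _  = refl
  ... | no j≰m = sym (trans (cong (λ c → pow F a j * ℕ→F F c) (k>n⇒nCk≡0 (ℕ.≰⇒> j≰m))) (zeroʳ _))

  Λ₁-suc : ∀ a m k → Λ₁ F a k (suc m) ≡ mulLinear a (λ k → Λ₁ F a k m) k
  Λ₁-suc a m -[1+ _ ]  = sym (trans (+-identityˡ _) (zeroʳ a))
  Λ₁-suc a m (+ zero)  = sym (trans (cong (_+_ (Λ₁ F a (+ 0) m)) (zeroʳ a)) (+-identityʳ _))
  Λ₁-suc a m (+ suc j) = begin
    Λ₁ F a (+ suc j) (suc m)                                 ≡⟨ Λ₁-+ a (suc j) (suc m) ⟩
    pow F a (suc j) * ℕ→F F (suc m C suc j)
      ≡⟨ cong (λ c → pow F a (suc j) * ℕ→F F c) (sym (nCk+nC[k+1]≡[n+1]C[k+1] m j)) ⟩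
    pow F a (suc j) * ℕ→F F (m C j ℕ.+ m C suc j)            ≡⟨ cong (pow F a (suc j) *_) (ℕ→F-+ (m C j) (m C suc j)) ⟩
    pow F a (suc j) * (ℕ→F F (m C j) + ℕ→F F (m C suc j))    ≡⟨ distribˡ _ _ _ ⟩
    pow F a (suc j) * ℕ→F F (m C j) + pow F a (suc j) * ℕ→F F (m C suc j)
      ≡⟨ +-comm _ _ ⟩
    pow F a (suc j) * ℕ→F F (m C suc j) + a * pow F a j * ℕ→F F (m C j)
      ≡⟨ cong₂ _+_ (sym (Λ₁-+ a (suc j) m)) (trans (*-assoc a _ _) (cong (a *_) (sym (Λ₁-+ a j m)))) ⟩
    Λ₁ F a (+ suc j) m + a * Λ₁ F a (+ j) m                  ∎

  Λ-cong : ∀ l a k {m m′ : Fin (suc l) → ℕ} → (∀ i → m i ≡ m′ i) → Λ F l a k m ≡ Λ F l a k m′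
  Λ-cong zero    a k m≗m′ = cong (Λ₁ F (a Fin.zero) k) (m≗m′ Fin.zero)
  Λ-cong (suc l) a k m≗m′ =
    mulBinomialPower-cong (a (fromℕ (suc l))) (m≗m′ (fromℕ (suc l)))
      (λ k → Λ-cong l (a ∘ inject₁) k (m≗m′ ∘ inject₁)) k

  Λ-zero : ∀ l a k → Λ F l a k (λ _ → 0) ≡ oneSeries k
  Λ-zero zero    a -[1+ _ ]  = refl
  Λ-zero zero    a (+ zero)  = trans (*-identityˡ _) (+-identityʳ 1#)
  Λ-zero zero    a (+ suc _) = refl
  Λ-zero (suc l) a k =
    trans (mulBinomialPower-zero (a (fromℕ (suc l))) (λ k → Λ F l (a ∘ inject₁) k (λ _ → 0)) k)
          (Λ-zero l (a ∘ inject₁) k)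

  Λ-increment : ∀ l a {m m′ : Fin (suc l) → ℕ} i → m′ i ≡ suc (m i) → (∀ j → j ≢ i → m′ j ≡ m j) →
           ∀ k → Λ F l a k m′ ≡ mulLinear (a i) (λ k → Λ F l a k m) k
  Λ-increment zero a Fin.zero m′i≡ _ k = trans (cong (Λ₁ F (a Fin.zero) k) m′i≡) (Λ₁-suc (a Fin.zero) _ k)
  Λ-increment (suc l) a {m} i m′i≡ m′j≡ k with view i
  ... | ‵fromℕ =
    trans (mulBinomialPower-cong (a (fromℕ (suc l))) m′i≡
            (λ k → Λ-cong l _ k λ j → m′j≡ (inject₁ j) (fromℕ≢inject₁ ∘ sym)) k)
          (mulBinomialPower-suc (a (fromℕ (suc l))) (m (fromℕ (suc l))) (λ k → Λ F l (a ∘ inject₁) k (m ∘ inject₁)) k)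
  ... | ‵inject₁ i′ =
    trans (mulBinomialPower-cong (a (fromℕ (suc l))) (m′j≡ (fromℕ (suc l)) fromℕ≢inject₁)
            (Λ-increment l (a ∘ inject₁) i′ m′i≡ λ j j≢i′ → m′j≡ (inject₁ j) (j≢i′ ∘ inject₁-injective)) k)
          (mulBinomialPower-mulLinear (a (fromℕ (suc l))) (m (fromℕ (suc l))) (a (inject₁ i′))
                                      (λ k → Λ F l (a ∘ inject₁) k (m ∘ inject₁)) k)

module Elementary {q : ℕ} (F : FiniteField q) where
  open FiniteField F renaming (_+_ to infixl 6 _+_; _*_ to infixl 7 _*_)
  open IsCommutativeRing isCommutativeRing using (+-comm; +-identityʳ; zeroʳ; isCommutativeSemiring)
  open ListSum isCommutativeSemiring
  open Coefficients F
  open ≡-Reasoning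

  subsetSum : ∀ {n} → (Vec Bool n → Bool) → Vec Carrier n → Carrier
  subsetSum {n} Q x = ∑ (allBools F n) λ b → if Q b then prodSel F b x else 0#

  subsetSum-cong : ∀ {n} {Q Q′ : Vec Bool n → Bool} x → (∀ b → Q b ≡ Q′ b) → subsetSum Q x ≡ subsetSum Q′ x
  subsetSum-cong {n} x Q≗Q′ =
    ∑-cong (allBools F n) λ b → cong (λ t → if t then prodSel F b x else 0#) (Q≗Q′ b)

  -- esym tests |b| = k by a local function of Defs that cannot be named; unification recovers it
  -- here, and `with` then evaluates it below.
  esym-selector : ∀ n k x → Σ (Vec Bool n → Bool) λ Q → esym F n k x ≡ subsetSum Q x
  esym-selector n k x = _ , refl

  esym-selector-correct : ∀ n k x b → proj₁ (esym-selector n k x) b ≡ does (countTrue F b ℕ.≟ k)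
  esym-selector-correct n k x b with countTrue F b ℕ.≟ k
  ... | yes c≡k = sym (dec-true (countTrue F b ℕ.≟ k) c≡k)
  ... | no c≢k  = sym (dec-false (countTrue F b ℕ.≟ k) c≢k)

  hasSize : ∀ {n} → ℤ → Vec Bool n → Bool
  hasSize (+ k)    b = does (countTrue F b ℕ.≟ k)
  hasSize -[1+ _ ] b = false

  esymℤ : ∀ {n} → ℤ → Vec Carrier n → Carrier
  esymℤ k = subsetSum (hasSize k)

  esym≡esymℤ : ∀ n k x → esym F n k x ≡ esymℤ (+ k) x
  esym≡esymℤ n k x = trans (proj₂ (esym-selector n k x)) (subsetSum-cong x (esym-selector-correct n k x))

  if-*ˡ : ∀ t a y → (if t then a * y else 0#) ≡ a * (if t then y else 0#)
  if-*ˡ true  a y = refl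
  if-*ˡ false a y = sym (zeroʳ a)

  subsetSum-∷ : ∀ {n} (Q : Vec Bool (suc n) → Bool) a x →
                subsetSum Q (a ∷ x) ≡ a * subsetSum (Q ∘ (true ∷_)) x + subsetSum (Q ∘ (false ∷_)) x
  subsetSum-∷ {n} Q a x = begin
    subsetSum Q (a ∷ x)
      ≡⟨ ∑-concatMap (λ t → List.map (t ∷_) (allBools F n)) (true ∷ false ∷ []) f ⟩
    ∑ (List.map (true ∷_) (allBools F n)) f + (∑ (List.map (false ∷_) (allBools F n)) f + 0#)
      ≡⟨ cong₂ _+_ (trans (∑-map (true ∷_) (allBools F n) f) true-part)
                   (trans (+-identityʳ _) (∑-map (false ∷_) (allBools F n) f)) ⟩
    a * subsetSum (Q ∘ (true ∷_)) x + subsetSum (Q ∘ (false ∷_)) x ∎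
    where
    f : Vec Bool (suc n) → Carrier
    f b = if Q b then prodSel F b (a ∷ x) else 0#
    true-part : ∑ (allBools F n) (f ∘ (true ∷_)) ≡ a * subsetSum (Q ∘ (true ∷_)) x
    true-part = trans (∑-cong (allBools F n) λ b → if-*ˡ (Q (true ∷ b)) a _) (∑-*ˡ (allBools F n) a _)

  esymℤ-[] : ∀ k → esymℤ k [] ≡ oneSeries k
  esymℤ-[] (+ zero)  = +-identityʳ 1#
  esymℤ-[] (+ suc _) = +-identityʳ 0#
  esymℤ-[] -[1+ _ ]  = +-identityʳ 0#

  -- Splitting on k lets hasSize k (true ∷ b) reduce to hasSize (k ℤ.- + 1) b.
  esymℤ-∷ : ∀ {n} k a (x : Vec Carrier n) → esymℤ k (a ∷ x) ≡ mulLinear a (λ k → esymℤ k x) k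
  esymℤ-∷ (+ zero)  a x = trans (subsetSum-∷ (hasSize (+ zero)) a x) (+-comm _ _)
  esymℤ-∷ (+ suc k) a x = trans (subsetSum-∷ (hasSize (+ suc k)) a x) (+-comm _ _)
  esymℤ-∷ -[1+ n ]  a x = trans (subsetSum-∷ (hasSize -[1+ n ]) a x) (+-comm _ _)

open ListSum ℕ.+-*-isCommutativeSemiring
private
  module + = CommutativeSemigroupProperties ℕ.+-commutativeSemigroup
open ≡-Reasoning

-- The multinomial coefficient as C(b, m₁) C(b - m₁, m₂) ⋯, matching the nesting of tuples.
binomialProduct : ∀ {s} → ℕ → Vec ℕ s → ℕ
binomialProduct b []       = 1
binomialProduct b (m ∷ ms) = (b C m) ℕ.* binomialProduct (b ∸ m) ms

typeSum : ∀ s → ℕ → (Vec ℕ s → ℕ) → ℕ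
typeSum s b h = ∑ (tuples s b) λ ms → binomialProduct b ms ℕ.* h ms

bump : ∀ {s} → Fin s → Vec ℕ s → Vec ℕ s
bump i v = Vec.updateAt v i suc

∑-tuples-split : ∀ s b (f : Vec ℕ (suc s) → ℕ) →
                 ∑ (tuples (suc s) b) f ≡ ∑ (upTo (suc b)) λ m → ∑ (tuples s (b ∸ m)) (f ∘ (m ∷_))
∑-tuples-split s b f =
  trans (∑-concatMap (λ m → List.map (m ∷_) (tuples s (b ∸ m))) (upTo (suc b)) f)
        (∑-cong (upTo (suc b)) λ m → ∑-map (m ∷_) (tuples s (b ∸ m)) f)

typeSum-split : ∀ s b h → typeSum (suc s) b h ≡ ∑ (upTo (suc b)) λ m → (b C m) ℕ.* typeSum s (b ∸ m) (h ∘ (m ∷_))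
typeSum-split s b h = trans (∑-tuples-split s b _) (∑-cong (upTo (suc b)) λ m →
  trans (∑-cong (tuples s (b ∸ m)) λ r → ℕ.*-assoc (b C m) _ (h (m ∷ r)))
        (∑-*ˡ (tuples s (b ∸ m)) (b C m) _))

typeSum-zero : ∀ s h → typeSum s 0 h ≡ h (Vec.replicate s 0)
typeSum-zero zero    h = trans (ℕ.+-identityʳ _) (ℕ.*-identityˡ _)
typeSum-zero (suc s) h =
  trans (typeSum-split s 0 h) (trans (ℕ.+-identityʳ _) (trans (ℕ.*-identityˡ _) (typeSum-zero s _)))

typeSum-suc : ∀ s b h → typeSum s (suc b) h ≡ typeSum s b h ℕ.+ ∑ (allFin s) λ i → typeSum s b (h ∘ bump i)
typeSum-suc zero    b h = sym (ℕ.+-identityʳ _)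
typeSum-suc (suc s) b h = begin
  typeSum (suc s) (suc b) h
    ≡⟨ typeSum-split s (suc b) h ⟩
  ∑ (upTo (suc (suc b))) (λ m → (suc b C m) ℕ.* f m)
    ≡⟨ ∑-pascal id refl (λ _ _ → refl) b f ⟩
  ∑ (upTo (suc b)) (λ m → (b C m) ℕ.* f m)
    ℕ.+ ∑ (upTo (suc b)) (λ m → (b C m) ℕ.* typeSum s (b ∸ m) (h ∘ (suc m ∷_)))
    ≡⟨ cong₂ ℕ._+_ f-part (sym (typeSum-split s b (h ∘ bump Fin.zero))) ⟩
  (T h ℕ.+ ∑ (allFin s) (λ i → T (h ∘ bump (Fin.suc i)))) ℕ.+ T (h ∘ bump Fin.zero)
    ≡⟨ +.xy∙z≈x∙zy (T h) (∑ (allFin s) (λ i → T (h ∘ bump (Fin.suc i)))) (T (h ∘ bump Fin.zero)) ⟩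
  T h ℕ.+ (T (h ∘ bump Fin.zero) ℕ.+ ∑ (allFin s) (λ i → T (h ∘ bump (Fin.suc i))))
    ≡⟨ cong (T h ℕ.+_) (sym (∑-allFin-suc s (λ i → T (h ∘ bump i)))) ⟩
  T h ℕ.+ ∑ (allFin (suc s)) (λ i → T (h ∘ bump i)) ∎
  where
  T : (Vec ℕ (suc s) → ℕ) → ℕ
  T = typeSum (suc s) b
  f g : ℕ → ℕ
  f m = typeSum s (suc b ∸ m) (h ∘ (m ∷_))
  g m = typeSum s (b ∸ m) (h ∘ (m ∷_))
  f-part : ∑ (upTo (suc b)) (λ m → (b C m) ℕ.* f m) ≡ T h ℕ.+ ∑ (allFin s) (λ i → T (h ∘ bump (Fin.suc i)))
  f-part = begin
    ∑ (upTo (suc b)) (λ m → (b C m) ℕ.* f m)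
      ≡⟨ ∑-cong-local (upTo (suc b)) (λ {m} m∈ → cong ((b C m) ℕ.*_)
           (trans (cong (λ c → typeSum s c (h ∘ (m ∷_))) (ℕ.+-∸-assoc 1 (ℕ.≤-pred (∈-upTo⁻ m∈))))
                  (typeSum-suc s (b ∸ m) (h ∘ (m ∷_))))) ⟩
    ∑ (upTo (suc b)) (λ m → (b C m) ℕ.* (g m ℕ.+ ∑ (allFin s) (λ i → typeSum s (b ∸ m) (h ∘ (m ∷_) ∘ bump i))))
      ≡⟨ trans (∑-cong (upTo (suc b)) λ m → ℕ.*-distribˡ-+ (b C m) _ _)
               (∑-+ (upTo (suc b)) (λ m → (b C m) ℕ.* g m) _) ⟩
    ∑ (upTo (suc b)) (λ m → (b C m) ℕ.* g m)
      ℕ.+ ∑ (upTo (suc b)) (λ m → (b C m) ℕ.* ∑ (allFin s) (λ i → typeSum s (b ∸ m) (h ∘ (m ∷_) ∘ bump i)))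
      ≡⟨ cong₂ ℕ._+_ (sym (typeSum-split s b h))
           (trans (∑-cong (upTo (suc b)) λ m → sym (∑-*ˡ (allFin s) (b C m) _))
           (trans (∑-comm (upTo (suc b)) (allFin s) _)
                  (∑-cong (allFin s) λ i → sym (typeSum-split s b (h ∘ bump (Fin.suc i)))))) ⟩
    T h ℕ.+ ∑ (allFin s) (λ i → T (h ∘ bump (Fin.suc i))) ∎

∈-tuples⇒sum≤ : ∀ s {b} {ms : Vec ℕ s} → ms ∈ tuples s b → Vec.sum ms ≤ b
∈-tuples⇒sum≤ zero    (here refl) = ℕ.z≤n
∈-tuples⇒sum≤ (suc s) {b} ms∈
  with find (∈-concatMap⁻ (λ m → List.map (m ∷_) (tuples s (b ∸ m))) {upTo (suc b)} ms∈)
... | m , m∈upTo , ms∈map with ∈-map⁻ (m ∷_) ms∈map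
... | r , r∈ , refl = subst (m ℕ.+ Vec.sum r ≤_) (ℕ.m+[n∸m]≡n (ℕ.≤-pred (∈-upTo⁻ m∈upTo)))
                            (ℕ.+-monoʳ-≤ m (∈-tuples⇒sum≤ s r∈))

binomial*factorials≡! : ∀ {m b} → m ≤ b → (b C m) ℕ.* (m ! ℕ.* (b ∸ m) !) ≡ b !
binomial*factorials≡! {m} {b} m≤b =
  trans (cong (ℕ._* (m ! ℕ.* (b ∸ m) !)) (nCk≡n!/k![n-k]! m≤b))
        (m/n*n≡m {{ℕ.m*n≢0 (m !) ((b ∸ m) !) {{ℕ._!≢0 m}} {{ℕ._!≢0 (b ∸ m)}}}} (k![n∸k]!∣n! m≤b))

binomialProduct*factorials≡! : ∀ {s} b (ms : Vec ℕ s) → Vec.sum ms ≤ b →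
                                binomialProduct b ms ℕ.* prodFact ((b ∸ Vec.sum ms) ∷ ms) ≡ b !
binomialProduct*factorials≡! b []       _     = trans (ℕ.*-identityˡ _) (ℕ.*-identityʳ _)
binomialProduct*factorials≡! b (m ∷ ms) Σ≤b = begin
  ((b C m) ℕ.* binomialProduct (b ∸ m) ms) ℕ.* ((b ∸ (m ℕ.+ S)) ! ℕ.* (m ! ℕ.* prodFact ms))
    ≡⟨ cong (λ c → ((b C m) ℕ.* binomialProduct (b ∸ m) ms) ℕ.* (c ! ℕ.* (m ! ℕ.* prodFact ms)))
            (sym (ℕ.∸-+-assoc b m S)) ⟩
  ((b C m) ℕ.* binomialProduct (b ∸ m) ms) ℕ.* ((b ∸ m ∸ S) ! ℕ.* (m ! ℕ.* prodFact ms))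
    ≡⟨ solve 5 (λ c p x f r → (c :* p) :* (x :* (f :* r)) := c :* (f :* (p :* (x :* r))))
             refl (b C m) (binomialProduct (b ∸ m) ms) ((b ∸ m ∸ S) !) (m !) (prodFact ms) ⟩
  (b C m) ℕ.* (m ! ℕ.* (binomialProduct (b ∸ m) ms ℕ.* ((b ∸ m ∸ S) ! ℕ.* prodFact ms)))
    ≡⟨ cong (λ c → (b C m) ℕ.* (m ! ℕ.* c)) (binomialProduct*factorials≡! (b ∸ m) ms S≤b∸m) ⟩
  (b C m) ℕ.* (m ! ℕ.* (b ∸ m) !)
    ≡⟨ binomial*factorials≡! (ℕ.m+n≤o⇒m≤o m Σ≤b) ⟩
  b ! ∎
  where
  open +-*-Solver
  S = Vec.sum ms
  S≤b∸m : S ≤ b ∸ m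
  S≤b∸m = ℕ.m+n≤o⇒m≤o∸n S (subst (ℕ._≤ b) (ℕ.+-comm m S) Σ≤b)

multinomial≡binomialProduct : ∀ {s} b (ms : Vec ℕ s) → Vec.sum ms ≤ b →
                              multinomial b ((b ∸ Vec.sum ms) ∷ ms) ≡ binomialProduct b ms
multinomial≡binomialProduct b ms Σ≤b =
  trans (/-congˡ {{prodFact≢0 ((b ∸ Vec.sum ms) ∷ ms)}} (sym (binomialProduct*factorials≡! b ms Σ≤b)))
        (m*n/n≡m (binomialProduct b ms) (prodFact ((b ∸ Vec.sum ms) ∷ ms)) {{prodFact≢0 ((b ∸ Vec.sum ms) ∷ ms)}})

module Enumerated {q : ℕ} (F : FiniteField q) (l : ℕ) (α : Fin (suc l) → FiniteField.Carrier F)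
  (α-injective : Injective _≡_ _≡_ α) (α≢0 : ∀ i → α i ≢ FiniteField.0# F)
  (α-onto : ∀ a → a ≢ FiniteField.0# F → ∃ λ i → α i ≡ a) where
  open FiniteField F renaming (_+_ to infixl 6 _+_; _*_ to infixl 7 _*_)
  open Coefficients F
  open Elementary F

  zero-or-α : ∀ a → a ≡ 0# ⊎ ∃ λ i → α i ≡ a
  zero-or-α a with a ≟ 0#
  ... | yes a≡0 = inj₁ a≡0
  ... | no a≢0  = inj₂ (α-onto a a≢0)

  multiplicity : ∀ {n} → Vec Carrier n → Fin (suc l) → ℕ
  multiplicity x i = Vec.count (α i ≟_) x

  multiplicity-0# : ∀ {n} (x : Vec Carrier n) i → multiplicity (0# ∷ x) i ≡ multiplicity x i
  multiplicity-0# x i =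
    cong (λ t → (if t then suc else id) (multiplicity x i)) (dec-false (α i ≟ 0#) (α≢0 i))

  multiplicity-α-same : ∀ {n} (x : Vec Carrier n) i → multiplicity (α i ∷ x) i ≡ suc (multiplicity x i)
  multiplicity-α-same x i =
    cong (λ t → (if t then suc else id) (multiplicity x i)) (dec-true (α i ≟ α i) refl)

  multiplicity-α-other : ∀ {n} (x : Vec Carrier n) i j → j ≢ i → multiplicity (α i ∷ x) j ≡ multiplicity x j
  multiplicity-α-other x i j j≢i =
    cong (λ t → (if t then suc else id) (multiplicity x j)) (dec-false (α j ≟ α i) (j≢i ∘ α-injective))

  esymℤ≡Λ : ∀ {n} (x : Vec Carrier n) k → esymℤ k x ≡ Λ F l α k (multiplicity x)
  esymℤ≡Λ []      k = trans (esymℤ-[] k) (sym (Λ-zero l α k))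
  esymℤ≡Λ (a ∷ x) k with zero-or-α a
  ... | inj₁ refl = begin
    esymℤ k (0# ∷ x)                    ≡⟨ trans (esymℤ-∷ k 0# x) (mulLinear-0# (λ k → esymℤ k x) k) ⟩
    esymℤ k x                           ≡⟨ esymℤ≡Λ x k ⟩
    Λ F l α k (multiplicity x)          ≡⟨ Λ-cong l α k (sym ∘ multiplicity-0# x) ⟩
    Λ F l α k (multiplicity (0# ∷ x))   ∎
  ... | inj₂ (i , refl) = begin
    esymℤ k (α i ∷ x)                                     ≡⟨ esymℤ-∷ k (α i) x ⟩
    mulLinear (α i) (λ k → esymℤ k x) k                   ≡⟨ mulLinear-cong (α i) (esymℤ≡Λ x) k ⟩
    mulLinear (α i) (λ k → Λ F l α k (multiplicity x)) k
      ≡⟨ Λ-increment l α i (multiplicity-α-same x i) (multiplicity-α-other x i) k ⟨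
    Λ F l α k (multiplicity (α i ∷ x))                    ∎

  typ : ∀ {n} → Vec Carrier n → Vec ℕ (suc l)
  typ x = Vec.tabulate (multiplicity x)

  esym≡Λ : ∀ n k (x : Vec Carrier n) → esym F n k x ≡ Λ F l α (+ k) (Vec.lookup (typ x))
  esym≡Λ n k x = trans (esym≡esymℤ n k x)
    (trans (esymℤ≡Λ x (+ k)) (Λ-cong l α (+ k) (sym ∘ Vec.lookup∘tabulate (multiplicity x))))

  typ-0# : ∀ {n} (x : Vec Carrier n) → typ (0# ∷ x) ≡ typ x
  typ-0# x = Vec.tabulate-cong (multiplicity-0# x)

  typ-α : ∀ {n} (x : Vec Carrier n) i → typ (α i ∷ x) ≡ bump i (typ x)
  typ-α x i = trans (Vec.tabulate-cong entry) (Vec.tabulate∘lookup (bump i (typ x)))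
    where
    entry : ∀ j → multiplicity (α i ∷ x) j ≡ Vec.lookup (bump i (typ x)) j
    entry j with j Fin.≟ i
    ... | yes refl = trans (multiplicity-α-same x i) (sym (trans (Vec.lookup∘updateAt i (typ x))
                                                                  (cong suc (Vec.lookup∘tabulate (multiplicity x) i))))
    ... | no j≢i   = trans (multiplicity-α-other x i j j≢i) (sym (trans (Vec.lookup∘updateAt′ j i j≢i (typ x))
                                                                       (Vec.lookup∘tabulate (multiplicity x) j)))

  elems↭0#∷α : elems ↭ 0# ∷ List.map α (allFin (suc l))
  elems↭0#∷α = ∼bag⇒↭ (unique∧set⇒bag elems-unique unique (mk⇔ (λ _ → member _) (λ _ → elems-complete _)))
    where
    unique = All.map⁺ (universal (λ i → α≢0 i ∘ sym) (allFin (suc l)))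
           ∷ Unique.map⁺ α-injective (Unique.allFin⁺ (suc l))
    member : ∀ a → a ∈ 0# ∷ List.map α (allFin (suc l))
    member a with zero-or-α a
    ... | inj₁ refl        = here refl
    ... | inj₂ (i , refl)  = there (∈-map⁺ α (∈-allFin i))

  ∑-points-suc : ∀ n (h : Vec ℕ (suc l) → ℕ) →
                 ∑ (points F (suc n)) (h ∘ typ)
                 ≡ ∑ (points F n) (h ∘ typ) ℕ.+ ∑ (allFin (suc l)) λ i → ∑ (points F n) (h ∘ bump i ∘ typ)
  ∑-points-suc n h = begin
    ∑ (points F (suc n)) (h ∘ typ)
      ≡⟨ trans (∑-concatMap (λ a → List.map (a ∷_) (points F n)) elems (h ∘ typ))
               (∑-cong elems λ a → ∑-map (a ∷_) (points F n) (h ∘ typ)) ⟩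
    ∑ elems g
      ≡⟨ sum-↭ (↭.map⁺ g elems↭0#∷α) ⟩
    g 0# ℕ.+ ∑ (List.map α (allFin (suc l))) g
      ≡⟨ cong₂ ℕ._+_ (∑-cong (points F n) (cong h ∘ typ-0#))
                     (trans (∑-map α (allFin (suc l)) g)
                            (∑-cong (allFin (suc l)) λ i → ∑-cong (points F n) λ x → cong h (typ-α x i))) ⟩
    ∑ (points F n) (h ∘ typ) ℕ.+ ∑ (allFin (suc l)) (λ i → ∑ (points F n) (h ∘ bump i ∘ typ)) ∎
    where
    g : Carrier → ℕ
    g a = ∑ (points F n) λ x → h (typ (a ∷ x))

  ∑-points≡typeSum : ∀ n h → ∑ (points F n) (h ∘ typ) ≡ typeSum (suc l) n h
  ∑-points≡typeSum zero h = begin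
    h (typ []) ℕ.+ 0                ≡⟨ ℕ.+-identityʳ _ ⟩
    h (Vec.tabulate λ _ → 0)        ≡⟨ cong h (trans (Vec.tabulate-allFin _) (Vec.map-const (Vec.allFin (suc l)) 0)) ⟩
    h (Vec.replicate (suc l) 0)     ≡⟨ typeSum-zero (suc l) h ⟨
    typeSum (suc l) 0 h             ∎
  ∑-points≡typeSum (suc n) h = begin
    ∑ (points F (suc n)) (h ∘ typ)
      ≡⟨ ∑-points-suc n h ⟩
    ∑ (points F n) (h ∘ typ) ℕ.+ ∑ (allFin (suc l)) (λ i → ∑ (points F n) (h ∘ bump i ∘ typ))
      ≡⟨ cong₂ ℕ._+_ (∑-points≡typeSum n h) (∑-cong (allFin (suc l)) λ i → ∑-points≡typeSum n (h ∘ bump i)) ⟩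
    typeSum (suc l) n h ℕ.+ ∑ (allFin (suc l)) (λ i → typeSum (suc l) n (h ∘ bump i))
      ≡⟨ typeSum-suc (suc l) n h ⟨
    typeSum (suc l) (suc n) h ∎

  ∑-points≡∑-multinomial : ∀ n h → ∑ (points F n) (h ∘ typ)
                           ≡ ∑ (tuples (suc l) n) λ ms → multinomial n ((n ∸ Vec.sum ms) ∷ ms) ℕ.* h ms
  ∑-points≡∑-multinomial n h = trans (∑-points≡typeSum n h) (∑-cong-local (tuples (suc l) n) λ {ms} ms∈ →
    cong (ℕ._* h ms) (sym (multinomial≡binomialProduct n ms (∈-tuples⇒sum≤ (suc l) ms∈))))

indicator : ∀ {p} → Maybe (Fin p) → Fin p → ℕ
indicator nothing   t = 0
indicator (just t₀) t with toℕ t₀ ℕ.≟ toℕ t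
... | yes _ = 1
... | no _  = 0

term≡indicator : ∀ {p} c (e : Maybe (Fin p)) t → term c e t ≡ + (c ℕ.* indicator e t)
term≡indicator c nothing   t = cong +_ (sym (ℕ.*-zeroʳ c))
term≡indicator c (just t₀) t with toℕ t₀ ℕ.≟ toℕ t
... | yes _ = cong +_ (sym (ℕ.*-identityʳ c))
... | no _  = cong +_ (sym (ℕ.*-zeroʳ c))

sumE-at : ∀ {p} {X : Set} (f : X → ExpSum p) (g : X → ℕ) t (xs : List X) →
          (∀ x → f x t ≡ + g x) → sumE (List.map f xs) t ≡ + ∑ xs g
sumE-at f g t []       f≡g = refl
sumE-at f g t (x ∷ xs) f≡g = cong₂ ℤ._+_ (f≡g x) (sumE-at f g t xs f≡g)

theorem3p2 : (n k : ℕ) → k ≤ n → (p r : ℕ) → Prime p → 1 ≤ r →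
    (F : FiniteField (p ^ r)) →
    (l : ℕ) → p ^ r ≡ suc (suc l) →
    (α : Fin (suc l) → FiniteField.Carrier F) →
    Injective _≡_ _≡_ α →
    (∀ i → α i ≢ FiniteField.0# F) →
    (∀ x → x ≢ FiniteField.0# F → ∃ λ i → α i ≡ x) →
    S-esym F p r n k ≈ζ RHS F p r l α n k
-- The two sides agree coefficientwise.
theorem3p2 n k _ p r _ _ F l _ α α-injective α≢0 α-onto = + 0 , λ t → begin
    S-esym F p r n k t                                        ≡⟨ S-esym-at t ⟩
    + ∑ (points F n) (coefficient t ∘ typ)                    ≡⟨ cong +_ (∑-points≡∑-multinomial n (coefficient t)) ⟩
    + ∑ (tuples (suc l) n) (weighted t)                       ≡⟨ RHS-at t ⟨
    RHS F p r l α n k t                                       ≡⟨ ℤ.+-identityʳ _ ⟨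
    RHS F p r l α n k t ℤ.+ + 0                               ∎
  where
  open Enumerated F l α α-injective α≢0 α-onto
  coefficient : Fin p → Vec ℕ (suc l) → ℕ
  coefficient t ms = indicator (toFp F p (Tr F p r (Λ F l α (+ k) (Vec.lookup ms)))) t
  weighted : Fin p → Vec ℕ (suc l) → ℕ
  weighted t ms = multinomial n ((n ∸ Vec.sum ms) ∷ ms) ℕ.* coefficient t ms
  S-esym-at : ∀ t → S-esym F p r n k t ≡ + ∑ (points F n) (coefficient t ∘ typ)
  S-esym-at t = sumE-at _ _ t (points F n) λ x →
    trans (term≡indicator 1 (toFp F p (Tr F p r (esym F n k x))) t)
          (cong +_ (trans (ℕ.*-identityˡ _) (cong (λ β → indicator (toFp F p (Tr F p r β)) t) (esym≡Λ n k x))))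
  RHS-at : ∀ t → RHS F p r l α n k t ≡ + ∑ (tuples (suc l) n) (weighted t)
  RHS-at t = sumE-at _ _ t (tuples (suc l) n) λ ms →
    term≡indicator (multinomial n ((n ∸ Vec.sum ms) ∷ ms)) (toFp F p (Tr F p r (Λ F l α (+ k) (Vec.lookup ms)))) t
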